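{- Let $\sigma, \tau \in \mathcal{D}(\rho)$. Then $\kappa(\sigma) \simeq \kappa(\tau)^{[w]}$ if and only if one of the following holds: (1) the pairs associated to $\sigma$ and $\tau$ are $((\delta_0,\delta_1),\{0\})$ and $((\delta_0,\delta_1+1),\{1\})$ (in either order) for some $(\delta_0,\delta_1)$; (2) the pairs associated to $\sigma$ and $\tau$ are $((\delta_0,\delta_1),\{0,1\})$ and $((\delta_0+1,\delta_1),\varnothing)$ (in either order) for some $(\delta_0,\delta_1)$.
   Context: Let $p$ be an odd prime, $F/\mathbb{Q}_p$ a finite extension with residue field $k$ of cardinality $p^2$ and ramification index $e$. Let $\Gamma = \mathrm{GL}_2(k)$. Fix $\varepsilon_0: k \hookrightarrow \overline{\mathbb{F}}_p$, $\varepsilon_1 = \varepsilon_0^p$. For $m \in \mathbb{Z}/(p^2-1)$ and $0 \le a_0,a_1 \le p-1$, $\det^m\otimes(a_0,a_1)$ is the Serre weight $(\mathrm{Sym}^{a_0}k^2\otimes_{\varepsilon_0}\overline{\mathbb{F}}_p)\otimes(\mathrm{Sym}^{a_1}k^2\otimes_{\varepsilon_1}\overline{\mathbb{F}}_p)\otimes(\varepsilon_0^m\circ\det)$; for such a weight, $(\det^c\otimes(a_0,a_1))^{[w]} = \det^{c+a_0+pa_1}\otimes(p-1-a_0,p-1-a_1)$. For $\sigma = \det^c\otimes(a_0,a_1)$ with $0\le a_i\le p-2$, $Q_{\{0\}}(\sigma)$ denotes the non-split length-two $\Gamma$-module with socle $\sigma$ and cosocle $\det^{c+a_0+1-p}\otimes(p-2-a_0,a_1+1)$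 (the quotient with socle $\sigma$ of the principal series $\mathrm{Ind}_B^\Gamma$ of the $U$-invariant character of the latter weight), and $Q_{\{1\}}(\sigma)$ the one with socle $\sigma$ and cosocle $\det^{c+pa_1+p-1}\otimes(a_0+1,p-2-a_1)$. Fix integers $m, r_0, r_1$ with $2e-1\le r_0\le p-2$, $2e-2\le r_1\le p-3$ (coming from a generic irreducible $\rho: G_F\to\mathrm{GL}_2(\overline{\mathbb{F}}_p)$ with $\rho|_{I_F}\simeq \omega_4^{m(p^2+1)}\otimes(\omega_4^{n}\oplus\omega_4^{p^2 n})$, $n = r_0+1+p(r_1+1)$). Write $(a_0,a_1)^+ = \det^{m+\frac12(r_0-a_0+p(r_1-a_1))}\otimes(a_0,a_1)$ and $(a_0,a_1)^- = \det^{m+\frac12(p^2-1+r_0-a_0+p(r_1-a_1))}\otimes(a_0,a_1)$. Let $\Delta = \{(\delta_0,\delta_1): 0\le\delta_0,\delta_1\le e-1\}$. For $(\delta_0,\delta_1)\in\Delta$ define four Serre weights, with associated pair $((\delta_0,\delta_1),J)$ and $\Gamma$-module $\widetilde D_{0,\sigma}$: $J=\varnothing$: $\sigma=(r_0-2\delta_0, r_1-2\delta_1)^+$, $\widetilde D_{0,\sigma}=Q_{\{1\}}(\sigma)$; $J=\{0\}$: $\sigma=(r_0-2\delta_0-1,p-r_1+2\delta_1-2)^-$, $\widetilde D_{0,\sigma}=Q_{\{0\}}(\sigma)$; $J=\{1\}$: $\sigma=(p-r_0+2\delta_0-2, r_1-2\delta_1+1)^+$, $\widetilde D_{0,\sigma}=Q_{\{0\}}(\sigma)$;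 $J=\{0,1\}$: $\sigma=(p-r_0+2\delta_0-1,p-r_1+2\delta_1-3)^-$, $\widetilde D_{0,\sigma}=Q_{\{1\}}(\sigma)$. $\mathcal{D}(\rho)$ is the set of these $4e^2$ (distinct) weights. For $\sigma\in\mathcal{D}(\rho)$, $\kappa(\sigma)$ denotes the (irreducible) $\Gamma$-cosocle of $\widetilde D_{0,\sigma}$. -}

module Defs where

open import Data.Nat as ℕ using (ℕ)
open import Data.Integer using (ℤ; +_; _+_; _-_; _*_)
open import Data.Integer.DivMod using (_/_)
open import Data.Integer.Divisibility using (_∣_)
open import Data.Product using (_×_; _,_)
open import Data.Sum using (_⊎_)
open import Relation.Binary.PropositionalEquality using (_≡_)

-- A Serre weight det^m ⊗ (a0,a1) of GL2(F_{p^2}), recorded by its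
-- parameters: the determinant exponent m (an integer, meaningful mod p^2-1)
-- and the two symmetric-power exponents a0, a1 (in [0, p-1]).
record SerreWeight : Set where
  constructor det^_⊗⟨_,_⟩
  field
    exp : ℤ
    a₀  : ℤ
    a₁  : ℤ
open SerreWeight public

-- The Serre weights det^m ⊗ (a0,a1), m ∈ Z/(p^2-1), 0 ≤ a_i ≤ p-1, are
-- pairwise non-isomorphic irreducible representations; so isomorphism is
-- equality of the parameters, with m taken modulo p^2-1.
_≅⟨_⟩_ : SerreWeight → ℕ → SerreWeight → Set
σ ≅⟨ p ⟩ τ = (((+ p) * (+ p) - + 1) ∣ (exp σ - exp τ)) × (a₀ σ ≡ a₀ τ) × (a₁ σ ≡ a₁ τ)

_^[w]⟨_⟩ : SerreWeight → ℕ → SerreWeight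
(det^ c ⊗⟨ x , y ⟩) ^[w]⟨ p ⟩ =
  det^ (c + x + (+ p) * y) ⊗⟨ (+ p) - + 1 - x , (+ p) - + 1 - y ⟩

cosocQ₀ : ℕ → SerreWeight → SerreWeight
cosocQ₀ p (det^ c ⊗⟨ x , y ⟩) = det^ (c + x + + 1 - + p) ⊗⟨ + p - + 2 - x , y + + 1 ⟩

cosocQ₁ : ℕ → SerreWeight → SerreWeight
cosocQ₁ p (det^ c ⊗⟨ x , y ⟩) = det^ (c + (+ p) * y + + p - + 1) ⊗⟨ x + + 1 , + p - + 2 - y ⟩

data J⊆01 : Set where
  J∅ J0 J1 J01 : J⊆01

-- (a0,a1)^+ and (a0,a1)^- for the data (p, m, r0, r1); the halving is of
-- an even integer in all cases used below.
plusW : ℕ → ℤ → ℕ → ℕ → ℤ → ℤ → SerreWeight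
plusW p m r₀ r₁ x y =
  det^ (m + ((+ r₀ - x + (+ p) * (+ r₁ - y)) / (+ 2))) ⊗⟨ x , y ⟩

minusW : ℕ → ℤ → ℕ → ℕ → ℤ → ℤ → SerreWeight
minusW p m r₀ r₁ x y =
  det^ (m + (((+ p) * (+ p) - + 1 + + r₀ - x + (+ p) * (+ r₁ - y)) / (+ 2))) ⊗⟨ x , y ⟩

weightD : ℕ → ℤ → ℕ → ℕ → ℕ → ℕ → J⊆01 → SerreWeight
weightD p m r₀ r₁ δ₀ δ₁ J∅  =
  plusW  p m r₀ r₁ (+ r₀ - + (2 ℕ.* δ₀)) (+ r₁ - + (2 ℕ.* δ₁))
weightD p m r₀ r₁ δ₀ δ₁ J0  =
  minusW p m r₀ r₁ (+ r₀ - + (2 ℕ.* δ₀) - + 1) (+ p - + r₁ + + (2 ℕ.* δ₁) - + 2)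
weightD p m r₀ r₁ δ₀ δ₁ J1  =
  plusW  p m r₀ r₁ (+ p - + r₀ + + (2 ℕ.* δ₀) - + 2) (+ r₁ - + (2 ℕ.* δ₁) + + 1)
weightD p m r₀ r₁ δ₀ δ₁ J01 =
  minusW p m r₀ r₁ (+ p - + r₀ + + (2 ℕ.* δ₀) - + 1) (+ p - + r₁ + + (2 ℕ.* δ₁) - + 3)

-- κ(σ): the cosocle of D̃_{0,σ} (Q_{1}(σ) for J = ∅, {0,1}; Q_{0}(σ) for J = {0}, {1})
κ : ℕ → ℤ → ℕ → ℕ → ℕ → ℕ → J⊆01 → SerreWeight
κ p m r₀ r₁ δ₀ δ₁ J∅  = cosocQ₁ p (weightD p m r₀ r₁ δ₀ δ₁ J∅)
κ p m r₀ r₁ δ₀ δ₁ J0  = cosocQ₀ p (weightD p m r₀ r₁ δ₀ δ₁ J0)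
κ p m r₀ r₁ δ₀ δ₁ J1  = cosocQ₀ p (weightD p m r₀ r₁ δ₀ δ₁ J1)
κ p m r₀ r₁ δ₀ δ₁ J01 = cosocQ₁ p (weightD p m r₀ r₁ δ₀ δ₁ J01)

{-# OPTIONS --safe #-}
-- A weight det^c ⊗ (a₀,a₁) is determined by (a₀,a₁) and c mod p²-1. For weights with the
-- same (a₀,a₁) the condition on c is a congruence mod 2(p²-1) between the exponents
-- 2c + a₀ + p a₁ through which the centre of GL₂(k) acts. This central exponent equals
-- 2m + r₀ + p r₁ for every (a₀,a₁)⁺ and grows by p²-1 under (·)⁻, under passing to the
-- cosocle of Q_{1}(σ) and under [w], while Q_{0}(σ) preserves it; so κ(σ) ≅ κ(τ)^[w] forces
-- the numbers of such steps for σ and τ to have different parities. For the eight pairs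
-- (J,J') that survive, the equations on (a₀,a₁) for (J,J') and for (J',J) are equivalent,
-- as [w] is an involution on (a₀,a₁). These equations are affine in 2δ: for (∅,{1}) and
-- ({0},{0,1}) they fail modulo 2 because p is odd, and for ({0},{1}) and ({0,1},∅) they
-- are exactly the stated relations between δ and δ'.
module Submission where

open import Defs
open import Data.Nat using (ℕ; suc)
open import Data.Nat.Primality using (Prime; ¬prime[0]; ¬prime[1]; prime⇒irreducible)
open import Data.Empty using (⊥-elim)
open import Data.List using (_∷_; [])
open import Data.Product using (_×_; _,_)
open import Data.Product.Function.NonDependent.Propositional using (_×-⇔_)
open import Data.Sum using (_⊎_; inj₁; inj₂)
open import Function.Base using (_∘_)
open import Function.Bundles using (_⇔_; mk⇔; module Equivalence)
open Equivalence using (to; from)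
open import Function.Properties.Equivalence using () renaming (refl to ⇔-refl; trans to ⇔-trans)
open import Relation.Nullary using (¬_)
open import Relation.Binary.PropositionalEquality
  using (_≡_; _≢_; refl; sym; trans; cong; cong₂; subst; module ≡-Reasoning)

-- The integer operators are opened only in this block: the statement of lemma3p1 uses those of ℕ.
module _ where
  open import Data.Integer using (ℤ; +_; -_; _+_; _-_; _*_; ∣_∣; NonZero)
  open import Data.Integer.Properties
    using (abs-*; pos-*; *-comm; *-identityˡ; +-identityˡ; +-identityʳ; +-injective;
           *-distribˡ-+; i≡j⇒i-j≡0; i-j≡0⇒i≡j)
  open import Data.Integer.DivMod using (_/_; _%_; n%d<d; a≡a%n+[a/n]*n)
  open import Data.Integer.Divisibility.Signed
    using (_∣_; divides; ∣-refl; ∣m∣n⇒∣m+n; ∣m∣n⇒∣m-n; ∣n⇒∣m*n;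
           *-monoʳ-∣; *-monoˡ-∣; *-cancelˡ-∣; *-cancelʳ-∣; ∣ᵤ⇒∣; ∣⇒∣ᵤ)
  open import Data.Integer.Tactic.RingSolver using (solve-∀; solve)
  import Data.Nat as ℕ
  import Data.Nat.Properties as ℕ
  open ≡-Reasoning

  2∤odd : ∀ k → ¬ (+ 2 ∣ + 1 + k * + 2)
  2∤odd k (divides q 1+2k≡2q) =
    ℕ.even≢odd ∣ q - k ∣ 0 (sym (trans (cong ∣_∣ 1≡2[q-k]) (abs-* (+ 2) (q - k))))
    where
    1≡2[q-k] : + 1 ≡ + 2 * (q - k)
    1≡2[q-k] = begin
      + 1                     ≡⟨ solve (k ∷ []) ⟩
      + 1 + k * + 2 - k * + 2 ≡⟨ cong (_- k * + 2) 1+2k≡2q ⟩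
      q * + 2 - k * + 2       ≡⟨ solve (q ∷ k ∷ []) ⟩
      + 2 * (q - k)           ∎

  2*[n/2]≡n : ∀ {n} → + 2 ∣ n → + 2 * (n / + 2) ≡ n
  2*[n/2]≡n {n} 2∣n with n % + 2 | n%d<d n (+ 2) | a≡a%n+[a/n]*n n (+ 2)
  ... | 0           | _                  | n≡[n/2]*2   =
    sym (trans n≡[n/2]*2 (trans (+-identityˡ _) (*-comm (n / + 2) (+ 2))))
  ... | 1           | _                  | n≡1+[n/2]*2 =
    ⊥-elim (2∤odd (n / + 2) (subst (+ 2 ∣_) n≡1+[n/2]*2 2∣n))
  ... | suc (suc _) | ℕ.s≤s (ℕ.s≤s ()) | _

  prime≢2⇒2∤ : ∀ {p} → Prime p → p ≢ 2 → ¬ (+ 2 ∣ + p)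
  prime≢2⇒2∤ pr p≢2 2∣p with prime⇒irreducible pr (∣⇒∣ᵤ 2∣p)
  ... | inj₁ ()
  ... | inj₂ 2≡p = p≢2 (sym 2≡p)

  ≡⇔≡-by-difference : ∀ {x y u v : ℤ} → x - y ≡ u - v → (x ≡ y ⇔ u ≡ v)
  ≡⇔≡-by-difference {x} {y} {u} {v} gap = mk⇔
    (λ x≡y → i-j≡0⇒i≡j u v (trans (sym gap) (i≡j⇒i-j≡0 x≡y)))
    (λ u≡v → i-j≡0⇒i≡j x y (trans gap (i≡j⇒i-j≡0 u≡v)))

  ≢-by-odd-difference : ∀ {x y E P : ℤ} → x - y ≡ E - P → + 2 ∣ E → ¬ (+ 2 ∣ P) → x ≢ y
  ≢-by-odd-difference {E = E} {P} gap 2∣E 2∤P x≡y =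
    2∤P (subst (+ 2 ∣_) (i-j≡0⇒i≡j E P (trans (sym gap) (i≡j⇒i-j≡0 x≡y))) 2∣E)

  ≡-sym⇔ : ∀ {A : Set} {a b : A} → a ≡ b ⇔ b ≡ a
  ≡-sym⇔ = mk⇔ sym sym

  -- Written as in Defs, so that double δ is definitionally the 2δ occurring in weightD.
  double : ℕ → ℤ
  double n = + (2 ℕ.* n)

  2∣double : ∀ n → + 2 ∣ double n
  2∣double n = divides (+ n) (trans (pos-* 2 n) (*-comm (+ 2) (+ n)))

  double≡⇔ : ∀ {m n} → double m ≡ double n ⇔ m ≡ n
  double≡⇔ {m} {n} = mk⇔ (ℕ.*-cancelˡ-≡ m n 2 ∘ +-injective) (cong double)

  double+2≡⇔ : ∀ {m n} → double m + + 2 ≡ double n ⇔ suc m ≡ n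
  double+2≡⇔ {m} {n} = subst (λ d → d ≡ double n ⇔ suc m ≡ n) double-suc double≡⇔
    where
    double-suc : double (suc m) ≡ double m + + 2
    double-suc = cong +_ (trans (ℕ.*-suc 2 m) (ℕ.+-comm 2 (2 ℕ.* m)))

  p²-1 : ℕ → ℤ
  p²-1 p = + p * + p - + 1

  p²-1-nonZero : ∀ {p} → Prime p → NonZero (p²-1 p)
  p²-1-nonZero {0}           pr = ⊥-elim (¬prime[0] pr)
  p²-1-nonZero {1}           pr = ⊥-elim (¬prime[1] pr)
  p²-1-nonZero {suc (suc _)} _  = _

  -- A scalar z ∈ k^× acts on det^c ⊗ (a₀,a₁) by ε₀(z)^(2c + a₀ + p a₁).
  centralExponent : ℕ → SerreWeight → ℤ
  centralExponent p σ = + 2 * exp σ + a₀ σ + + p * a₁ σ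

  SameSymPowers : SerreWeight → SerreWeight → Set
  SameSymPowers σ τ = a₀ σ ≡ a₀ τ × a₁ σ ≡ a₁ τ

  ≅⇔centralExponent∣×SameSymPowers : ∀ p σ τ → σ ≅⟨ p ⟩ τ ⇔
    (+ 2 * p²-1 p ∣ centralExponent p σ - centralExponent p τ × SameSymPowers σ τ)
  ≅⇔centralExponent∣×SameSymPowers p (det^ c ⊗⟨ x , y ⟩) (det^ c' ⊗⟨ x' , y' ⟩) = mk⇔
    (λ { (N∣c-c' , refl , refl) →
           subst (+ 2 * p²-1 p ∣_) (sym (difference (+ p) c c' x y)) (*-monoʳ-∣ (+ 2) (∣ᵤ⇒∣ N∣c-c'))
         , refl , refl })
    (λ { (2N∣Δ , refl , refl) →
           ∣⇒∣ᵤ (*-cancelˡ-∣ (+ 2) (subst (+ 2 * p²-1 p ∣_) (difference (+ p) c c' x y) 2N∣Δ))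
         , refl , refl })
    where
    difference : ∀ P c c' x y → + 2 * c + x + P * y - (+ 2 * c' + x + P * y) ≡ + 2 * (c - c')
    difference = solve-∀

  centralExponent-^[w] : ∀ p σ → centralExponent p (σ ^[w]⟨ p ⟩) ≡ centralExponent p σ + p²-1 p
  centralExponent-^[w] p (det^ c ⊗⟨ x , y ⟩) = identity (+ p) c x y
    where
    identity : ∀ P c x y → + 2 * (c + x + P * y) + (P - + 1 - x) + P * (P - + 1 - y)
                           ≡ + 2 * c + x + P * y + (P * P - + 1)
    identity = solve-∀

  centralExponent-cosocQ₀ : ∀ p σ → centralExponent p (cosocQ₀ p σ) ≡ centralExponent p σ
  centralExponent-cosocQ₀ p (det^ c ⊗⟨ x , y ⟩) = identity (+ p) c x y
    where
    identity : ∀ P c x y → + 2 * (c + x + + 1 - P) + (P - + 2 - x) + P * (y + + 1)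
                           ≡ + 2 * c + x + P * y
    identity = solve-∀

  centralExponent-cosocQ₁ : ∀ p σ → centralExponent p (cosocQ₁ p σ) ≡ centralExponent p σ + p²-1 p
  centralExponent-cosocQ₁ p (det^ c ⊗⟨ x , y ⟩) = identity (+ p) c x y
    where
    identity : ∀ P c x y → + 2 * (c + P * y + P - + 1) + (x + + 1) + P * (P - + 2 - y)
                           ≡ + 2 * c + x + P * y + (P * P - + 1)
    identity = solve-∀

  centralExponent-det^[m+n/2] : ∀ p m n x y → + 2 ∣ n →
    centralExponent p (det^ (m + n / + 2) ⊗⟨ x , y ⟩) ≡ + 2 * m + n + x + + p * y
  centralExponent-det^[m+n/2] p m n x y 2∣n = cong (λ e → e + x + + p * y) (begin
    + 2 * (m + n / + 2)       ≡⟨ *-distribˡ-+ (+ 2) m (n / + 2) ⟩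
    + 2 * m + + 2 * (n / + 2) ≡⟨ cong (_+_ (+ 2 * m)) (2*[n/2]≡n 2∣n) ⟩
    + 2 * m + n               ∎)

  centralExponent-plusW : ∀ p m r₀ r₁ x y → + 2 ∣ + r₀ - x + + p * (+ r₁ - y) →
    centralExponent p (plusW p m r₀ r₁ x y) ≡ + 2 * m + + r₀ + + p * + r₁
  centralExponent-plusW p m r₀ r₁ x y 2∣n =
    trans (centralExponent-det^[m+n/2] p m _ x y 2∣n) (identity (+ p) m (+ r₀) (+ r₁) x y)
    where
    identity : ∀ P m R₀ R₁ x y → + 2 * m + (R₀ - x + P * (R₁ - y)) + x + P * y
                                 ≡ + 2 * m + R₀ + P * R₁
    identity = solve-∀

  centralExponent-minusW : ∀ p m r₀ r₁ x y → + 2 ∣ p²-1 p + + r₀ - x + + p * (+ r₁ - y) →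
    centralExponent p (minusW p m r₀ r₁ x y) ≡ + 2 * m + + r₀ + + p * + r₁ + p²-1 p
  centralExponent-minusW p m r₀ r₁ x y 2∣n =
    trans (centralExponent-det^[m+n/2] p m _ x y 2∣n) (identity (+ p) m (+ r₀) (+ r₁) x y)
    where
    identity : ∀ P m R₀ R₁ x y → + 2 * m + (P * P - + 1 + R₀ - x + P * (R₁ - y)) + x + P * y
                                 ≡ + 2 * m + R₀ + P * R₁ + (P * P - + 1)
    identity = solve-∀

  sameSymPowers-^[w]-swap : ∀ p σ τ → SameSymPowers σ (τ ^[w]⟨ p ⟩) → SameSymPowers τ (σ ^[w]⟨ p ⟩)
  sameSymPowers-^[w]-swap p (det^ _ ⊗⟨ _ , _ ⟩) (det^ _ ⊗⟨ x , y ⟩) (refl , refl) =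
    complement-involutive (+ p) x , complement-involutive (+ p) y
    where
    complement-involutive : ∀ P x → x ≡ P - + 1 - (P - + 1 - x)
    complement-involutive = solve-∀

  -- The numerators r₀ - a₀ + p (r₁ - a₁) (plus p²-1 for (·)⁻) of the determinant exponents
  -- of the weights of D(ρ), with T = 2δ.
  numerator-J∅-even : ∀ P R₀ R₁ {T₀ T₁} → + 2 ∣ T₀ → + 2 ∣ T₁ →
    + 2 ∣ R₀ - (R₀ - T₀) + P * (R₁ - (R₁ - T₁))
  numerator-J∅-even P R₀ R₁ (divides D₀ refl) (divides D₁ refl) =
    divides (D₀ + P * D₁) (solve (P ∷ R₀ ∷ R₁ ∷ D₀ ∷ D₁ ∷ []))

  numerator-J0-even : ∀ P R₀ R₁ {T₀ T₁} → + 2 ∣ T₀ → + 2 ∣ T₁ →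
    + 2 ∣ P * P - + 1 + R₀ - (R₀ - T₀ - + 1) + P * (R₁ - (P - R₁ + T₁ - + 2))
  numerator-J0-even P R₀ R₁ (divides D₀ refl) (divides D₁ refl) =
    divides (D₀ + P * R₁ - P * D₁ + P) (solve (P ∷ R₀ ∷ R₁ ∷ D₀ ∷ D₁ ∷ []))

  numerator-J1-even : ∀ P R₀ R₁ {T₀ T₁} → + 2 ∣ T₀ → + 2 ∣ T₁ →
    + 2 ∣ R₀ - (P - R₀ + T₀ - + 2) + P * (R₁ - (R₁ - T₁ + + 1))
  numerator-J1-even P R₀ R₁ (divides D₀ refl) (divides D₁ refl) =
    divides (R₀ + + 1 - P - D₀ + P * D₁) (solve (P ∷ R₀ ∷ R₁ ∷ D₀ ∷ D₁ ∷ []))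

  numerator-J01-even : ∀ P R₀ R₁ {T₀ T₁} → + 2 ∣ T₀ → + 2 ∣ T₁ →
    + 2 ∣ P * P - + 1 + R₀ - (P - R₀ + T₀ - + 1) + P * (R₁ - (P - R₁ + T₁ - + 3))
  numerator-J01-even P R₀ R₁ (divides D₀ refl) (divides D₁ refl) =
    divides (R₀ + P + P * R₁ - D₀ - P * D₁) (solve (P ∷ R₀ ∷ R₁ ∷ D₀ ∷ D₁ ∷ []))

  -- One factor p²-1 for a (·)⁻ weight and one for Q_{1}(σ).
  twist : J⊆01 → ℤ
  twist J∅  = + 1
  twist J0  = + 1
  twist J1  = + 0
  twist J01 = + 2

  Paired : J⊆01 → J⊆01 → ℕ → ℕ → ℕ → ℕ → Set
  Paired J J' δ₀ δ₁ δ₀' δ₁' =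
    ((J ≡ J0) × (J' ≡ J1) × (δ₀' ≡ δ₀) × (δ₁' ≡ suc δ₁))
    ⊎ ((J' ≡ J0) × (J ≡ J1) × (δ₀ ≡ δ₀') × (δ₁ ≡ suc δ₁'))
    ⊎ ((J ≡ J01) × (J' ≡ J∅) × (δ₀' ≡ suc δ₀) × (δ₁' ≡ δ₁))
    ⊎ ((J' ≡ J01) × (J ≡ J∅) × (δ₀ ≡ suc δ₀') × (δ₁ ≡ δ₁'))

  module _ (p : ℕ) (m : ℤ) (r₀ r₁ : ℕ) where

    κᵨ : ℕ → ℕ → J⊆01 → SerreWeight
    κᵨ = κ p m r₀ r₁

    centralExponent⁺ : ℤ
    centralExponent⁺ = + 2 * m + + r₀ + + p * + r₁

    centralExponent-κ : ∀ δ₀ δ₁ J →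
      centralExponent p (κᵨ δ₀ δ₁ J) ≡ centralExponent⁺ + twist J * p²-1 p
    centralExponent-κ δ₀ δ₁ J∅ =
      trans (centralExponent-cosocQ₁ p (weightD p m r₀ r₁ δ₀ δ₁ J∅))
        (cong₂ _+_
          (centralExponent-plusW p m r₀ r₁ _ _
            (numerator-J∅-even (+ p) (+ r₀) (+ r₁) (2∣double δ₀) (2∣double δ₁)))
          (sym (*-identityˡ (p²-1 p))))
    centralExponent-κ δ₀ δ₁ J0 =
      trans (centralExponent-cosocQ₀ p (weightD p m r₀ r₁ δ₀ δ₁ J0))
        (trans
          (centralExponent-minusW p m r₀ r₁ _ _
            (numerator-J0-even (+ p) (+ r₀) (+ r₁) (2∣double δ₀) (2∣double δ₁)))
          (cong (_+_ centralExponent⁺) (sym (*-identityˡ (p²-1 p)))))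
    centralExponent-κ δ₀ δ₁ J1 =
      trans (centralExponent-cosocQ₀ p (weightD p m r₀ r₁ δ₀ δ₁ J1))
        (trans
          (centralExponent-plusW p m r₀ r₁ _ _
            (numerator-J1-even (+ p) (+ r₀) (+ r₁) (2∣double δ₀) (2∣double δ₁)))
          (sym (+-identityʳ centralExponent⁺)))
    centralExponent-κ δ₀ δ₁ J01 =
      trans (centralExponent-cosocQ₁ p (weightD p m r₀ r₁ δ₀ δ₁ J01))
        (trans
          (cong (_+ p²-1 p) (centralExponent-minusW p m r₀ r₁ _ _
            (numerator-J01-even (+ p) (+ r₀) (+ r₁) (2∣double δ₀) (2∣double δ₁))))
          (twice centralExponent⁺ (p²-1 p)))
      where
      twice : ∀ c N → c + N + N ≡ c + + 2 * N
      twice = solve-∀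

    twist-criterion : Prime p → ∀ δ₀ δ₁ J δ₀' δ₁' J' →
      (+ 2 * p²-1 p ∣ centralExponent p (κᵨ δ₀ δ₁ J) - centralExponent p (κᵨ δ₀' δ₁' J' ^[w]⟨ p ⟩))
      ⇔ (+ 2 ∣ twist J - twist J' - + 1)
    twist-criterion pr δ₀ δ₁ J δ₀' δ₁' J' =
      subst (λ d → (+ 2 * p²-1 p ∣ d) ⇔ (+ 2 ∣ twist J - twist J' - + 1)) (sym centralExponent-gap)
        (mk⇔ (*-cancelʳ-∣ (p²-1 p) {{p²-1-nonZero pr}}) (*-monoˡ-∣ (p²-1 p)))
      where
      identity : ∀ c s t N → c + s * N - (c + t * N + N) ≡ (s - t - + 1) * N
      identity = solve-∀
      centralExponent-gap :
        centralExponent p (κᵨ δ₀ δ₁ J) - centralExponent p (κᵨ δ₀' δ₁' J' ^[w]⟨ p ⟩)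
        ≡ (twist J - twist J' - + 1) * p²-1 p
      centralExponent-gap = begin
        centralExponent p (κᵨ δ₀ δ₁ J) - centralExponent p (κᵨ δ₀' δ₁' J' ^[w]⟨ p ⟩)
          ≡⟨ cong₂ _-_ (centralExponent-κ δ₀ δ₁ J)
               (trans (centralExponent-^[w] p (κᵨ δ₀' δ₁' J'))
                      (cong (_+ p²-1 p) (centralExponent-κ δ₀' δ₁' J'))) ⟩
        centralExponent⁺ + twist J * p²-1 p - (centralExponent⁺ + twist J' * p²-1 p + p²-1 p)
          ≡⟨ identity centralExponent⁺ (twist J) (twist J') (p²-1 p) ⟩
        (twist J - twist J' - + 1) * p²-1 p
          ∎

    -- In each gap the two terms are the components of κ(σ) and κ(τ)^[w], as Defs computes
    -- them, with T = 2δ and T' = 2δ'.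
    sameSymPowers-J0-J1 : ∀ δ₀ δ₁ δ₀' δ₁' →
      SameSymPowers (κᵨ δ₀ δ₁ J0) (κᵨ δ₀' δ₁' J1 ^[w]⟨ p ⟩) ⇔ (δ₀' ≡ δ₀ × δ₁' ≡ suc δ₁)
    sameSymPowers-J0-J1 δ₀ δ₁ δ₀' δ₁' =
      ⇔-trans (≡⇔≡-by-difference (gap₀ (+ p) (+ r₀) (double δ₀) (double δ₀')))
              (⇔-trans double≡⇔ ≡-sym⇔)
      ×-⇔
      ⇔-trans (≡⇔≡-by-difference (gap₁ (+ p) (+ r₁) (double δ₁) (double δ₁')))
              (⇔-trans double+2≡⇔ ≡-sym⇔)
      where
      gap₀ : ∀ P R T T' → P - + 2 - (R - T - + 1) - (P - + 1 - (P - + 2 - (P - R + T' - + 2)))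
                          ≡ T - T'
      gap₀ = solve-∀
      gap₁ : ∀ P R T T' → P - R + T - + 2 + + 1 - (P - + 1 - (R - T' + + 1 + + 1)) ≡ T + + 2 - T'
      gap₁ = solve-∀

    sameSymPowers-J01-J∅ : ∀ δ₀ δ₁ δ₀' δ₁' →
      SameSymPowers (κᵨ δ₀ δ₁ J01) (κᵨ δ₀' δ₁' J∅ ^[w]⟨ p ⟩) ⇔ (δ₀' ≡ suc δ₀ × δ₁' ≡ δ₁)
    sameSymPowers-J01-J∅ δ₀ δ₁ δ₀' δ₁' =
      ⇔-trans (≡⇔≡-by-difference (gap₀ (+ p) (+ r₀) (double δ₀) (double δ₀')))
              (⇔-trans double+2≡⇔ ≡-sym⇔)
      ×-⇔
      ⇔-trans (≡⇔≡-by-difference (gap₁ (+ p) (+ r₁) (double δ₁) (double δ₁')))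
              double≡⇔
      where
      gap₀ : ∀ P R T T' → P - R + T - + 1 + + 1 - (P - + 1 - (R - T' + + 1)) ≡ T + + 2 - T'
      gap₀ = solve-∀
      gap₁ : ∀ P R T T' → P - + 2 - (P - R + T - + 3) - (P - + 1 - (P - + 2 - (R - T'))) ≡ T' - T
      gap₁ = solve-∀

    ¬sameSymPowers-J∅-J1 : ¬ (+ 2 ∣ + p) → ∀ δ₀ δ₁ δ₀' δ₁' →
      ¬ SameSymPowers (κᵨ δ₀ δ₁ J∅) (κᵨ δ₀' δ₁' J1 ^[w]⟨ p ⟩)
    ¬sameSymPowers-J∅-J1 2∤p δ₀ _ δ₀' _ (a₀≡ , _) =
      ≢-by-odd-difference (gap₀ (+ p) (+ r₀) (double δ₀) (double δ₀')) 2∣E 2∤p a₀≡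
      where
      gap₀ : ∀ P R T T' → R - T + + 1 - (P - + 1 - (P - + 2 - (P - R + T' - + 2)))
                          ≡ (R + + 1) * + 2 - T - T' - P
      gap₀ = solve-∀
      2∣E : + 2 ∣ (+ r₀ + + 1) * + 2 - double δ₀ - double δ₀'
      2∣E = ∣m∣n⇒∣m-n (∣m∣n⇒∣m-n (∣n⇒∣m*n (+ r₀ + + 1) ∣-refl) (2∣double δ₀)) (2∣double δ₀')

    ¬sameSymPowers-J0-J01 : ¬ (+ 2 ∣ + p) → ∀ δ₀ δ₁ δ₀' δ₁' →
      ¬ SameSymPowers (κᵨ δ₀ δ₁ J0) (κᵨ δ₀' δ₁' J01 ^[w]⟨ p ⟩)
    ¬sameSymPowers-J0-J01 2∤p δ₀ _ δ₀' _ (a₀≡ , _) =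
      ≢-by-odd-difference (gap₀ (+ p) (+ r₀) (double δ₀) (double δ₀')) 2∣E 2∤p a₀≡
      where
      gap₀ : ∀ P R T T' → P - + 2 - (R - T - + 1) - (P - + 1 - (P - R + T' - + 1 + + 1))
                          ≡ (P - R) * + 2 + T + T' - P
      gap₀ = solve-∀
      2∣E : + 2 ∣ (+ p - + r₀) * + 2 + double δ₀ + double δ₀'
      2∣E = ∣m∣n⇒∣m+n (∣m∣n⇒∣m+n (∣n⇒∣m*n (+ p - + r₀) ∣-refl) (2∣double δ₀)) (2∣double δ₀')

    twist∣×sameSymPowers⇒paired : ¬ (+ 2 ∣ + p) → ∀ δ₀ δ₁ J δ₀' δ₁' J' →
      + 2 ∣ twist J - twist J' - + 1 × SameSymPowers (κᵨ δ₀ δ₁ J) (κᵨ δ₀' δ₁' J' ^[w]⟨ p ⟩) →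
      Paired J J' δ₀ δ₁ δ₀' δ₁'
    twist∣×sameSymPowers⇒paired 2∤p δ₀ δ₁ J δ₀' δ₁' J' (t , s) = go J J' t s
      where
      swap : ∀ J J' → SameSymPowers (κᵨ δ₀ δ₁ J) (κᵨ δ₀' δ₁' J' ^[w]⟨ p ⟩) →
             SameSymPowers (κᵨ δ₀' δ₁' J') (κᵨ δ₀ δ₁ J ^[w]⟨ p ⟩)
      swap J J' = sameSymPowers-^[w]-swap p (κᵨ δ₀ δ₁ J) (κᵨ δ₀' δ₁' J')
      go : ∀ J J' → + 2 ∣ twist J - twist J' - + 1 →
           SameSymPowers (κᵨ δ₀ δ₁ J) (κᵨ δ₀' δ₁' J' ^[w]⟨ p ⟩) → Paired J J' δ₀ δ₁ δ₀' δ₁'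
      go J∅  J∅  t _ = ⊥-elim (2∤odd (- + 1) t)
      go J∅  J0  t _ = ⊥-elim (2∤odd (- + 1) t)
      go J∅  J1  _ s = ⊥-elim (¬sameSymPowers-J∅-J1 2∤p δ₀ δ₁ δ₀' δ₁' s)
      go J∅  J01 _ s =
        inj₂ (inj₂ (inj₂ (refl , refl , to (sameSymPowers-J01-J∅ δ₀' δ₁' δ₀ δ₁) (swap J∅ J01 s))))
      go J0  J∅  t _ = ⊥-elim (2∤odd (- + 1) t)
      go J0  J0  t _ = ⊥-elim (2∤odd (- + 1) t)
      go J0  J1  _ s = inj₁ (refl , refl , to (sameSymPowers-J0-J1 δ₀ δ₁ δ₀' δ₁') s)
      go J0  J01 _ s = ⊥-elim (¬sameSymPowers-J0-J01 2∤p δ₀ δ₁ δ₀' δ₁' s)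
      go J1  J∅  _ s = ⊥-elim (¬sameSymPowers-J∅-J1 2∤p δ₀' δ₁' δ₀ δ₁ (swap J1 J∅ s))
      go J1  J0  _ s =
        inj₂ (inj₁ (refl , refl , to (sameSymPowers-J0-J1 δ₀' δ₁' δ₀ δ₁) (swap J1 J0 s)))
      go J1  J1  t _ = ⊥-elim (2∤odd (- + 1) t)
      go J1  J01 t _ = ⊥-elim (2∤odd (- + 2) t)
      go J01 J∅  _ s = inj₂ (inj₂ (inj₁ (refl , refl , to (sameSymPowers-J01-J∅ δ₀ δ₁ δ₀' δ₁') s)))
      go J01 J0  _ s = ⊥-elim (¬sameSymPowers-J0-J01 2∤p δ₀' δ₁' δ₀ δ₁ (swap J01 J0 s))
      go J01 J1  t _ = ⊥-elim (2∤odd (+ 0) t)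
      go J01 J01 t _ = ⊥-elim (2∤odd (- + 1) t)

    paired⇒twist∣×sameSymPowers : ∀ δ₀ δ₁ J δ₀' δ₁' J' → Paired J J' δ₀ δ₁ δ₀' δ₁' →
      + 2 ∣ twist J - twist J' - + 1 × SameSymPowers (κᵨ δ₀ δ₁ J) (κᵨ δ₀' δ₁' J' ^[w]⟨ p ⟩)
    paired⇒twist∣×sameSymPowers δ₀ δ₁ _ δ₀' δ₁' _ (inj₁ (refl , refl , δ's)) =
      divides (+ 0) refl , from (sameSymPowers-J0-J1 δ₀ δ₁ δ₀' δ₁') δ's
    paired⇒twist∣×sameSymPowers δ₀ δ₁ _ δ₀' δ₁' _ (inj₂ (inj₁ (refl , refl , δ's))) =
      divides (- + 1) refl ,
      sameSymPowers-^[w]-swap p (κᵨ δ₀' δ₁' J0) (κᵨ δ₀ δ₁ J1)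
        (from (sameSymPowers-J0-J1 δ₀' δ₁' δ₀ δ₁) δ's)
    paired⇒twist∣×sameSymPowers δ₀ δ₁ _ δ₀' δ₁' _ (inj₂ (inj₂ (inj₁ (refl , refl , δ's)))) =
      divides (+ 0) refl , from (sameSymPowers-J01-J∅ δ₀ δ₁ δ₀' δ₁') δ's
    paired⇒twist∣×sameSymPowers δ₀ δ₁ _ δ₀' δ₁' _ (inj₂ (inj₂ (inj₂ (refl , refl , δ's)))) =
      divides (- + 1) refl ,
      sameSymPowers-^[w]-swap p (κᵨ δ₀' δ₁' J01) (κᵨ δ₀ δ₁ J∅)
        (from (sameSymPowers-J01-J∅ δ₀' δ₁' δ₀ δ₁) δ's)

open import Data.Nat using (_+_; _*_; _≤_; _<_)
open import Data.Integer using (ℤ)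

lemma3p1 : (p e : ℕ) → Prime p → p ≢ 2 → 1 ≤ e →
    (m : ℤ) (r₀ r₁ : ℕ) →
    2 * e ≤ r₀ + 1 → r₀ + 2 ≤ p → 2 * e ≤ r₁ + 2 → r₁ + 3 ≤ p →
    (δ₀ δ₁ : ℕ) (J : J⊆01) → δ₀ < e → δ₁ < e →
    (δ₀' δ₁' : ℕ) (J' : J⊆01) → δ₀' < e → δ₁' < e →
    (κ p m r₀ r₁ δ₀ δ₁ J ≅⟨ p ⟩ (κ p m r₀ r₁ δ₀' δ₁' J' ^[w]⟨ p ⟩))
    ⇔
    (((J ≡ J0) × (J' ≡ J1) × (δ₀' ≡ δ₀) × (δ₁' ≡ suc δ₁))
     ⊎ ((J' ≡ J0) × (J ≡ J1) × (δ₀ ≡ δ₀') × (δ₁ ≡ suc δ₁'))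
     ⊎ ((J ≡ J01) × (J' ≡ J∅) × (δ₀' ≡ suc δ₀) × (δ₁' ≡ δ₁))
     ⊎ ((J' ≡ J01) × (J ≡ J∅) × (δ₀ ≡ suc δ₀') × (δ₁ ≡ δ₁')))
lemma3p1 p _ pr p≢2 _ m r₀ r₁ _ _ _ _ δ₀ δ₁ J _ _ δ₀' δ₁' J' _ _ =
  ⇔-trans (≅⇔centralExponent∣×SameSymPowers p (κ p m r₀ r₁ δ₀ δ₁ J)
                                               (κ p m r₀ r₁ δ₀' δ₁' J' ^[w]⟨ p ⟩))
  (⇔-trans (twist-criterion p m r₀ r₁ pr δ₀ δ₁ J δ₀' δ₁' J' ×-⇔ ⇔-refl)
    (mk⇔ (twist∣×sameSymPowers⇒paired p m r₀ r₁ (prime≢2⇒2∤ pr p≢2) δ₀ δ₁ J δ₀' δ₁' J')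
         (paired⇒twist∣×sameSymPowers p m r₀ r₁ δ₀ δ₁ J δ₀' δ₁' J')))
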